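{- For positive integers $k,l$ let $H_{kl}$ be the grid graph with vertex set $\{B_{ij}: (i,j)\in\{0,\dots,k-1\}\times\{0,\dots,l-1\}\}$, where $B_{ij}$ and $B_{i'j'}$ are adjacent iff $|i-i'|+|j-j'|=1$. Call $B_{ij}$ gray if $i+j$ is even and white otherwise. Let $T=\{B_{ij}: i,j\in\{2,3\}\}$ and $T1=\{B_{ij}: i,j\in\{1,2,3,4\}\}\setminus T$. Then: (i) $H_{66}$ has a Hamiltonian path from any gray vertex of $T1$ to any white vertex of $T$; (ii) $H_{66}$ has a Hamiltonian path from any white vertex of $T1$ to any gray vertex of $T$; (iii) statements (i) and (ii) also hold with $H_{66}$ replaced by $H_{67}$ and by $H_{76}$. -}

module Defs where

open import Data.Nat using (ℕ; _+_; _≤_)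
open import Data.Nat.Divisibility using (_∣_)
open import Data.Nat using (∣_-_∣)
open import Data.Fin using (Fin; toℕ)
open import Data.Product using (_×_; _,_; proj₁; proj₂; ∃)
open import Data.List using (List; _∷_; [])
open import Data.List.Relation.Unary.Linked using (Linked)
open import Data.List.Relation.Unary.Unique.Propositional using (Unique)
open import Data.List.Membership.Propositional using (_∈_)
open import Relation.Binary.PropositionalEquality using (_≡_)
open import Relation.Nullary using (¬_)

Vertex : ℕ → ℕ → Set
Vertex k l = Fin k × Fin l

row col : ∀ {k l} → Vertex k l → ℕ
row v = toℕ (proj₁ v)
col v = toℕ (proj₂ v)

Adj : ∀ {k l} → Vertex k l → Vertex k l → Set
Adj u v = ∣ row u - row v ∣ + ∣ col u - col v ∣ ≡ 1

Gray : ∀ {k l} → Vertex k l → Set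
Gray v = 2 ∣ (row v + col v)

White : ∀ {k l} → Vertex k l → Set
White v = ¬ Gray v

In23 : ℕ → Set
In23 i = 2 ≤ i × i ≤ 3

In1234 : ℕ → Set
In1234 i = 1 ≤ i × i ≤ 4

InT : ∀ {k l} → Vertex k l → Set
InT v = In23 (row v) × In23 (col v)

InT1 : ∀ {k l} → Vertex k l → Set
InT1 v = (In1234 (row v) × In1234 (col v)) × ¬ InT v

lastOf : ∀ {A : Set} → A → List A → A
lastOf x [] = x
lastOf x (y ∷ ys) = lastOf y ys

record HamPath (k l : ℕ) (s t : Vertex k l) : Set where
  field
    rest     : List (Vertex k l)
    ends     : lastOf s rest ≡ t
    distinct : Unique (s ∷ rest)
    covers   : ∀ v → v ∈ (s ∷ rest)
    adjacent : Linked Adj (s ∷ rest)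

HamProperty : ℕ → ℕ → Set
HamProperty k l =
  (∀ (s t : Vertex k l) → InT1 s → Gray s → InT t → White t → HamPath k l s t)
  × (∀ (s t : Vertex k l) → InT1 s → White s → InT t → Gray t → HamPath k l s t)

-- Every required path is exhibited explicitly and checked by evaluation. Mirroring the
-- rows of a grid with an even number of rows swaps the two colours and fixes T and T1,
-- so the mirror images of the paths for (i) settle (ii); transposition fixes colours,
-- T and T1, so the paths for H₇₆ are the transposes of those for H₆₇.

module Submission where

open import Defs
open import Data.Bool using (if_then_else_; _∧_)
open import Data.Fin using (Fin; fromℕ; fromℕ<; opposite)
open import Data.Fin.Properties using (all?) renaming (_≟_ to _≟ᶠ_)
open import Data.List using (List; []; _∷_; map)
open import Data.List.Relation.Unary.Linked using (Linked; linked?)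
open import Data.List.Relation.Unary.Unique.Propositional using (Unique)
open import Data.List.Membership.Propositional using (_∈_)
open import Data.Nat using (ℕ; suc; _+_; _/_; _%_; _≤?_; _<?_; ∣_-_∣) renaming (_≟_ to _≟ⁿ_)
open import Data.Nat.Divisibility using (_∣?_)
open import Data.Product using (_×_; _,_; swap)
open import Data.Product.Properties using (≡-dec)
open import Relation.Binary.Definitions using (DecidableEquality)
open import Relation.Binary.PropositionalEquality using (_≡_)
open import Relation.Nullary using (Dec; yes; no; does; ¬?)
open import Relation.Nullary.Decidable using (True; toWitness; map′; _×-dec_; _→-dec_)

-- For each pair of endpoints s, t: the proposed vertices following s on a path to t.
Routing : ℕ → ℕ → Set
Routing k l = Vertex k l → Vertex k l → List (Vertex k l)

module _ {k l : ℕ} where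

  _≟ᵛ_ : DecidableEquality (Vertex k l)
  _≟ᵛ_ = ≡-dec _≟ᶠ_ _≟ᶠ_

  open import Data.List.Membership.DecPropositional _≟ᵛ_ using (_∈?_)
  open import Data.List.Relation.Unary.Unique.DecPropositional _≟ᵛ_ using (unique?)

  allVertices? : {P : Vertex k l → Set} → (∀ v → Dec (P v)) → Dec (∀ v → P v)
  allVertices? P? = map′ (λ h (i , j) → h i j) (λ h i j → h (i , j))
    (all? λ i → all? λ j → P? (i , j))

  adj? : (u v : Vertex k l) → Dec (Adj u v)
  adj? u v = ∣ row u - row v ∣ + ∣ col u - col v ∣ ≟ⁿ 1

  gray? : (v : Vertex k l) → Dec (Gray v)
  gray? v = 2 ∣? (row v + col v)

  inT? : (v : Vertex k l) → Dec (InT v)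
  inT? v = in23? (row v) ×-dec in23? (col v)
    where in23? : ∀ i → Dec (In23 i)
          in23? i = (2 ≤? i) ×-dec (i ≤? 3)

  inT1? : (v : Vertex k l) → Dec (InT1 v)
  inT1? v = (in1234? (row v) ×-dec in1234? (col v)) ×-dec ¬? (inT? v)
    where in1234? : ∀ i → Dec (In1234 i)
          in1234? i = (1 ≤? i) ×-dec (i ≤? 4)

  IsHamPath : (s t : Vertex k l) → List (Vertex k l) → Set
  IsHamPath s t rest =
    lastOf s rest ≡ t × Unique (s ∷ rest) × (∀ v → v ∈ s ∷ rest) × Linked Adj (s ∷ rest)

  isHamPath? : ∀ s t rest → Dec (IsHamPath s t rest)
  isHamPath? s t rest =
    (lastOf s rest ≟ᵛ t) ×-dec unique? (s ∷ rest)
      ×-dec allVertices? (_∈? s ∷ rest) ×-dec linked? adj? (s ∷ rest)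

  toHamPath : ∀ {s t rest} → IsHamPath s t rest → HamPath k l s t
  toHamPath {rest = rest} (ends , distinct , covers , adjacent) =
    record { rest = rest ; ends = ends ; distinct = distinct ; covers = covers ; adjacent = adjacent }

  GrayToWhite WhiteToGray : Vertex k l → Vertex k l → Set
  GrayToWhite s t = InT1 s × Gray s × InT t × White t
  WhiteToGray s t = InT1 s × White s × InT t × Gray t

  Serves : (Vertex k l → Vertex k l → Set) → Routing k l → Set
  Serves P r = ∀ s t → P s t → IsHamPath s t (r s t)

  serves? : {P : Vertex k l → Vertex k l → Set} → (∀ s t → Dec (P s t)) → ∀ r → Dec (Serves P r)
  serves? P? r = allVertices? λ s → allVertices? λ t → P? s t →-dec isHamPath? s t (r s t)

  grayToWhite? : ∀ s t → Dec (GrayToWhite s t)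
  grayToWhite? s t = inT1? s ×-dec gray? s ×-dec inT? t ×-dec ¬? (gray? t)

  whiteToGray? : ∀ s t → Dec (WhiteToGray s t)
  whiteToGray? s t = inT1? s ×-dec ¬? (gray? s) ×-dec inT? t ×-dec gray? t

  hamProperty : (r₁ r₂ : Routing k l) →
    {True (serves? grayToWhite? r₁ ×-dec serves? whiteToGray? r₂)} → HamProperty k l
  hamProperty r₁ r₂ {valid} with toWitness valid
  ... | serves₁ , serves₂ =
    (λ s t s∈T1 gray t∈T white → toHamPath (serves₁ s t (s∈T1 , gray , t∈T , white))) ,
    (λ s t s∈T1 white t∈T gray → toHamPath (serves₂ s t (s∈T1 , white , t∈T , gray)))

relabel : ∀ {k l k′ l′} → (Vertex k l → Vertex k′ l′) → (Vertex k′ l′ → Vertex k l) →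
  Routing k l → Routing k′ l′
relabel f g r s t = map f (r (g s) (g t))

transpose : ∀ {k l} → Routing k l → Routing l k
transpose = relabel swap swap

mirrorRow : ∀ {k l} → Vertex k l → Vertex k l
mirrorRow (i , j) = opposite i , j

mirrorRows : ∀ {k l} → Routing k l → Routing k l
mirrorRows = relabel mirrorRow mirrorRow

clampFin : ∀ {n} → ℕ → Fin (suc n)
clampFin {n} m with m <? suc n
... | yes m<1+n = fromℕ< m<1+n
... | no _ = fromℕ n

-- Vertex B_ij is written as the two-digit numeral ij.
cell : ∀ {k l} → ℕ → Vertex (suc k) (suc l)
cell ij = clampFin (ij / 10) , clampFin (ij % 10)

fromTable : ∀ {k l} → List (List ℕ) → Routing (suc k) (suc l)
fromTable [] s t = []
fromTable ([] ∷ paths) s t = fromTable paths s t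
fromTable ((u ∷ rest) ∷ paths) s t =
  if does (cell u ≟ᵛ s) ∧ does (lastOf (cell u) (map cell rest) ≟ᵛ t)
  then map cell rest else fromTable paths s t

grayToWhitePaths66 : List (List ℕ)
grayToWhitePaths66 =
    (11 ∷ 01 ∷ 00 ∷ 10 ∷ 20 ∷ 30 ∷ 40 ∷ 50 ∷ 51 ∷ 41 ∷ 31 ∷ 21 ∷
     22 ∷ 32 ∷ 42 ∷ 52 ∷ 53 ∷ 43 ∷ 33 ∷ 34 ∷ 44 ∷ 54 ∷ 55 ∷ 45 ∷
     35 ∷ 25 ∷ 15 ∷ 05 ∷ 04 ∷ 03 ∷ 02 ∷ 12 ∷ 13 ∷ 14 ∷ 24 ∷ 23 ∷ [])
  ∷ (11 ∷ 01 ∷ 00 ∷ 10 ∷ 20 ∷ 30 ∷ 40 ∷ 50 ∷ 51 ∷ 41 ∷ 31 ∷ 21 ∷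
     22 ∷ 12 ∷ 02 ∷ 03 ∷ 13 ∷ 23 ∷ 33 ∷ 43 ∷ 44 ∷ 34 ∷ 24 ∷ 14 ∷
     04 ∷ 05 ∷ 15 ∷ 25 ∷ 35 ∷ 45 ∷ 55 ∷ 54 ∷ 53 ∷ 52 ∷ 42 ∷ 32 ∷ [])
  ∷ (13 ∷ 03 ∷ 04 ∷ 05 ∷ 15 ∷ 14 ∷ 24 ∷ 25 ∷ 35 ∷ 45 ∷ 55 ∷ 54 ∷
     44 ∷ 34 ∷ 33 ∷ 43 ∷ 53 ∷ 52 ∷ 42 ∷ 32 ∷ 31 ∷ 41 ∷ 51 ∷ 50 ∷
     40 ∷ 30 ∷ 20 ∷ 10 ∷ 00 ∷ 01 ∷ 02 ∷ 12 ∷ 11 ∷ 21 ∷ 22 ∷ 23 ∷ [])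
  ∷ (13 ∷ 03 ∷ 04 ∷ 05 ∷ 15 ∷ 14 ∷ 24 ∷ 25 ∷ 35 ∷ 45 ∷ 55 ∷ 54 ∷
     44 ∷ 34 ∷ 33 ∷ 23 ∷ 22 ∷ 12 ∷ 02 ∷ 01 ∷ 00 ∷ 10 ∷ 11 ∷ 21 ∷
     20 ∷ 30 ∷ 40 ∷ 50 ∷ 51 ∷ 52 ∷ 53 ∷ 43 ∷ 42 ∷ 41 ∷ 31 ∷ 32 ∷ [])
  ∷ (24 ∷ 25 ∷ 35 ∷ 45 ∷ 55 ∷ 54 ∷ 44 ∷ 34 ∷ 33 ∷ 43 ∷ 53 ∷ 52 ∷
     42 ∷ 32 ∷ 22 ∷ 12 ∷ 11 ∷ 21 ∷ 31 ∷ 41 ∷ 51 ∷ 50 ∷ 40 ∷ 30 ∷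
     20 ∷ 10 ∷ 00 ∷ 01 ∷ 02 ∷ 03 ∷ 04 ∷ 05 ∷ 15 ∷ 14 ∷ 13 ∷ 23 ∷ [])
  ∷ (24 ∷ 25 ∷ 35 ∷ 45 ∷ 55 ∷ 54 ∷ 44 ∷ 34 ∷ 33 ∷ 43 ∷ 53 ∷ 52 ∷
     42 ∷ 41 ∷ 51 ∷ 50 ∷ 40 ∷ 30 ∷ 20 ∷ 10 ∷ 00 ∷ 01 ∷ 11 ∷ 12 ∷
     02 ∷ 03 ∷ 04 ∷ 05 ∷ 15 ∷ 14 ∷ 13 ∷ 23 ∷ 22 ∷ 21 ∷ 31 ∷ 32 ∷ [])
  ∷ (31 ∷ 30 ∷ 40 ∷ 50 ∷ 51 ∷ 41 ∷ 42 ∷ 52 ∷ 53 ∷ 43 ∷ 33 ∷ 32 ∷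
     22 ∷ 21 ∷ 20 ∷ 10 ∷ 00 ∷ 01 ∷ 11 ∷ 12 ∷ 02 ∷ 03 ∷ 13 ∷ 14 ∷
     04 ∷ 05 ∷ 15 ∷ 25 ∷ 35 ∷ 45 ∷ 55 ∷ 54 ∷ 44 ∷ 34 ∷ 24 ∷ 23 ∷ [])
  ∷ (31 ∷ 30 ∷ 40 ∷ 50 ∷ 51 ∷ 41 ∷ 42 ∷ 52 ∷ 53 ∷ 43 ∷ 33 ∷ 23 ∷
     13 ∷ 14 ∷ 24 ∷ 34 ∷ 44 ∷ 54 ∷ 55 ∷ 45 ∷ 35 ∷ 25 ∷ 15 ∷ 05 ∷
     04 ∷ 03 ∷ 02 ∷ 12 ∷ 11 ∷ 01 ∷ 00 ∷ 10 ∷ 20 ∷ 21 ∷ 22 ∷ 32 ∷ [])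
  ∷ (42 ∷ 52 ∷ 53 ∷ 43 ∷ 33 ∷ 32 ∷ 22 ∷ 12 ∷ 11 ∷ 21 ∷ 31 ∷ 41 ∷
     51 ∷ 50 ∷ 40 ∷ 30 ∷ 20 ∷ 10 ∷ 00 ∷ 01 ∷ 02 ∷ 03 ∷ 13 ∷ 14 ∷
     04 ∷ 05 ∷ 15 ∷ 25 ∷ 35 ∷ 45 ∷ 55 ∷ 54 ∷ 44 ∷ 34 ∷ 24 ∷ 23 ∷ [])
  ∷ (42 ∷ 52 ∷ 53 ∷ 43 ∷ 33 ∷ 23 ∷ 13 ∷ 14 ∷ 24 ∷ 34 ∷ 44 ∷ 54 ∷
     55 ∷ 45 ∷ 35 ∷ 25 ∷ 15 ∷ 05 ∷ 04 ∷ 03 ∷ 02 ∷ 12 ∷ 22 ∷ 21 ∷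
     11 ∷ 01 ∷ 00 ∷ 10 ∷ 20 ∷ 30 ∷ 40 ∷ 50 ∷ 51 ∷ 41 ∷ 31 ∷ 32 ∷ [])
  ∷ (44 ∷ 54 ∷ 55 ∷ 45 ∷ 35 ∷ 25 ∷ 15 ∷ 05 ∷ 04 ∷ 14 ∷ 24 ∷ 34 ∷
     33 ∷ 43 ∷ 53 ∷ 52 ∷ 42 ∷ 32 ∷ 22 ∷ 12 ∷ 11 ∷ 21 ∷ 31 ∷ 41 ∷
     51 ∷ 50 ∷ 40 ∷ 30 ∷ 20 ∷ 10 ∷ 00 ∷ 01 ∷ 02 ∷ 03 ∷ 13 ∷ 23 ∷ [])
  ∷ (44 ∷ 54 ∷ 55 ∷ 45 ∷ 35 ∷ 25 ∷ 15 ∷ 05 ∷ 04 ∷ 14 ∷ 24 ∷ 34 ∷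
     33 ∷ 43 ∷ 53 ∷ 52 ∷ 42 ∷ 41 ∷ 51 ∷ 50 ∷ 40 ∷ 30 ∷ 20 ∷ 10 ∷
     00 ∷ 01 ∷ 11 ∷ 12 ∷ 02 ∷ 03 ∷ 13 ∷ 23 ∷ 22 ∷ 21 ∷ 31 ∷ 32 ∷ [])
  ∷ []

grayToWhitePaths67 : List (List ℕ)
grayToWhitePaths67 =
    (11 ∷ 01 ∷ 00 ∷ 10 ∷ 20 ∷ 30 ∷ 40 ∷ 50 ∷ 51 ∷ 41 ∷ 31 ∷ 21 ∷
     22 ∷ 32 ∷ 42 ∷ 52 ∷ 53 ∷ 43 ∷ 33 ∷ 34 ∷ 44 ∷ 54 ∷ 55 ∷ 56 ∷
     46 ∷ 45 ∷ 35 ∷ 36 ∷ 26 ∷ 16 ∷ 06 ∷ 05 ∷ 15 ∷ 25 ∷ 24 ∷ 14 ∷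
     04 ∷ 03 ∷ 02 ∷ 12 ∷ 13 ∷ 23 ∷ [])
  ∷ (11 ∷ 01 ∷ 00 ∷ 10 ∷ 20 ∷ 30 ∷ 40 ∷ 50 ∷ 51 ∷ 41 ∷ 31 ∷ 21 ∷
     22 ∷ 12 ∷ 02 ∷ 03 ∷ 13 ∷ 23 ∷ 33 ∷ 43 ∷ 44 ∷ 34 ∷ 24 ∷ 14 ∷
     04 ∷ 05 ∷ 06 ∷ 16 ∷ 15 ∷ 25 ∷ 26 ∷ 36 ∷ 35 ∷ 45 ∷ 46 ∷ 56 ∷
     55 ∷ 54 ∷ 53 ∷ 52 ∷ 42 ∷ 32 ∷ [])
  ∷ (13 ∷ 03 ∷ 04 ∷ 14 ∷ 24 ∷ 34 ∷ 44 ∷ 45 ∷ 35 ∷ 25 ∷ 15 ∷ 05 ∷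
     06 ∷ 16 ∷ 26 ∷ 36 ∷ 46 ∷ 56 ∷ 55 ∷ 54 ∷ 53 ∷ 43 ∷ 33 ∷ 32 ∷
     42 ∷ 52 ∷ 51 ∷ 50 ∷ 40 ∷ 41 ∷ 31 ∷ 30 ∷ 20 ∷ 10 ∷ 00 ∷ 01 ∷
     02 ∷ 12 ∷ 11 ∷ 21 ∷ 22 ∷ 23 ∷ [])
  ∷ (13 ∷ 03 ∷ 04 ∷ 14 ∷ 24 ∷ 23 ∷ 33 ∷ 34 ∷ 44 ∷ 45 ∷ 35 ∷ 25 ∷
     15 ∷ 05 ∷ 06 ∷ 16 ∷ 26 ∷ 36 ∷ 46 ∷ 56 ∷ 55 ∷ 54 ∷ 53 ∷ 43 ∷
     42 ∷ 52 ∷ 51 ∷ 50 ∷ 40 ∷ 41 ∷ 31 ∷ 30 ∷ 20 ∷ 10 ∷ 00 ∷ 01 ∷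
     02 ∷ 12 ∷ 11 ∷ 21 ∷ 22 ∷ 32 ∷ [])
  ∷ (24 ∷ 34 ∷ 44 ∷ 54 ∷ 55 ∷ 56 ∷ 46 ∷ 45 ∷ 35 ∷ 36 ∷ 26 ∷ 25 ∷
     15 ∷ 16 ∷ 06 ∷ 05 ∷ 04 ∷ 14 ∷ 13 ∷ 03 ∷ 02 ∷ 12 ∷ 22 ∷ 32 ∷
     42 ∷ 41 ∷ 31 ∷ 21 ∷ 11 ∷ 01 ∷ 00 ∷ 10 ∷ 20 ∷ 30 ∷ 40 ∷ 50 ∷
     51 ∷ 52 ∷ 53 ∷ 43 ∷ 33 ∷ 23 ∷ [])
  ∷ (24 ∷ 34 ∷ 44 ∷ 54 ∷ 55 ∷ 56 ∷ 46 ∷ 45 ∷ 35 ∷ 36 ∷ 26 ∷ 25 ∷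
     15 ∷ 16 ∷ 06 ∷ 05 ∷ 04 ∷ 14 ∷ 13 ∷ 03 ∷ 02 ∷ 12 ∷ 22 ∷ 23 ∷
     33 ∷ 43 ∷ 53 ∷ 52 ∷ 42 ∷ 41 ∷ 51 ∷ 50 ∷ 40 ∷ 30 ∷ 20 ∷ 10 ∷
     00 ∷ 01 ∷ 11 ∷ 21 ∷ 31 ∷ 32 ∷ [])
  ∷ (31 ∷ 30 ∷ 40 ∷ 50 ∷ 51 ∷ 41 ∷ 42 ∷ 52 ∷ 53 ∷ 43 ∷ 33 ∷ 32 ∷
     22 ∷ 21 ∷ 20 ∷ 10 ∷ 00 ∷ 01 ∷ 11 ∷ 12 ∷ 02 ∷ 03 ∷ 13 ∷ 14 ∷
     04 ∷ 05 ∷ 06 ∷ 16 ∷ 15 ∷ 25 ∷ 26 ∷ 36 ∷ 46 ∷ 56 ∷ 55 ∷ 54 ∷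
     44 ∷ 45 ∷ 35 ∷ 34 ∷ 24 ∷ 23 ∷ [])
  ∷ (31 ∷ 30 ∷ 40 ∷ 50 ∷ 51 ∷ 41 ∷ 42 ∷ 52 ∷ 53 ∷ 43 ∷ 33 ∷ 23 ∷
     13 ∷ 14 ∷ 24 ∷ 34 ∷ 44 ∷ 54 ∷ 55 ∷ 56 ∷ 46 ∷ 45 ∷ 35 ∷ 36 ∷
     26 ∷ 25 ∷ 15 ∷ 16 ∷ 06 ∷ 05 ∷ 04 ∷ 03 ∷ 02 ∷ 12 ∷ 11 ∷ 01 ∷
     00 ∷ 10 ∷ 20 ∷ 21 ∷ 22 ∷ 32 ∷ [])
  ∷ (42 ∷ 52 ∷ 53 ∷ 43 ∷ 33 ∷ 32 ∷ 22 ∷ 12 ∷ 11 ∷ 21 ∷ 31 ∷ 41 ∷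
     51 ∷ 50 ∷ 40 ∷ 30 ∷ 20 ∷ 10 ∷ 00 ∷ 01 ∷ 02 ∷ 03 ∷ 13 ∷ 14 ∷
     04 ∷ 05 ∷ 06 ∷ 16 ∷ 15 ∷ 25 ∷ 26 ∷ 36 ∷ 46 ∷ 56 ∷ 55 ∷ 54 ∷
     44 ∷ 45 ∷ 35 ∷ 34 ∷ 24 ∷ 23 ∷ [])
  ∷ (42 ∷ 52 ∷ 53 ∷ 43 ∷ 33 ∷ 23 ∷ 13 ∷ 14 ∷ 24 ∷ 34 ∷ 44 ∷ 54 ∷
     55 ∷ 56 ∷ 46 ∷ 45 ∷ 35 ∷ 36 ∷ 26 ∷ 25 ∷ 15 ∷ 16 ∷ 06 ∷ 05 ∷
     04 ∷ 03 ∷ 02 ∷ 12 ∷ 22 ∷ 21 ∷ 11 ∷ 01 ∷ 00 ∷ 10 ∷ 20 ∷ 30 ∷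
     40 ∷ 50 ∷ 51 ∷ 41 ∷ 31 ∷ 32 ∷ [])
  ∷ (44 ∷ 54 ∷ 55 ∷ 56 ∷ 46 ∷ 45 ∷ 35 ∷ 36 ∷ 26 ∷ 16 ∷ 06 ∷ 05 ∷
     15 ∷ 25 ∷ 24 ∷ 34 ∷ 33 ∷ 43 ∷ 53 ∷ 52 ∷ 42 ∷ 32 ∷ 22 ∷ 12 ∷
     11 ∷ 21 ∷ 31 ∷ 41 ∷ 51 ∷ 50 ∷ 40 ∷ 30 ∷ 20 ∷ 10 ∷ 00 ∷ 01 ∷
     02 ∷ 03 ∷ 04 ∷ 14 ∷ 13 ∷ 23 ∷ [])
  ∷ (44 ∷ 54 ∷ 55 ∷ 56 ∷ 46 ∷ 45 ∷ 35 ∷ 36 ∷ 26 ∷ 16 ∷ 06 ∷ 05 ∷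
     15 ∷ 25 ∷ 24 ∷ 34 ∷ 33 ∷ 43 ∷ 53 ∷ 52 ∷ 42 ∷ 41 ∷ 51 ∷ 50 ∷
     40 ∷ 30 ∷ 20 ∷ 10 ∷ 00 ∷ 01 ∷ 11 ∷ 12 ∷ 02 ∷ 03 ∷ 04 ∷ 14 ∷
     13 ∷ 23 ∷ 22 ∷ 21 ∷ 31 ∷ 32 ∷ [])
  ∷ []

mainTheorem19 : HamProperty 6 6 × HamProperty 6 7 × HamProperty 7 6
mainTheorem19 =
  hamProperty routes66 (mirrorRows routes66) ,
  hamProperty routes67 (mirrorRows routes67) ,
  hamProperty (transpose routes67) (transpose (mirrorRows routes67))
  where
  routes66 : Routing 6 6
  routes66 = fromTable grayToWhitePaths66

  routes67 : Routing 6 7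
  routes67 = fromTable grayToWhitePaths67
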